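{- Let $n\ge1$ and $k,r\ge0$ with $k+r\le n-1$. The following two sets both have cardinality $\binom{n-k-1}{r}\binom{r+k}{r}$: (1) the set of properly-marked $\{L,R\}$-words of length $n-1$ with $k$ marked $L$-elements and $r$ unmarked $L$-elements; (2) the set of Kimberling paths ending at $(n-k,k)$ with $r$ internal vertices.
   Context: A properly-marked $\{L,R\}$-word is a word over the alphabet $\{L^u,L^m,R\}$ in which every occurrence of $L^m$ is either the last letter or is immediately followed by $L^u$ or $L^m$; occurrences of $L^m$ are marked $L$-elements and occurrences of $L^u$ unmarked $L$-elements. A Kimberling path is a lattice path starting at $(0,0)$ whose steps are vectors in $\mathbb{N}\times\mathbb{Z}_{\ge0}$ (positive horizontal displacement, non-negative vertical displacement, arbitrary length); its internal vertices are the points where consecutive steps meet (excluding start and end), so a path with $r$ internal vertices has $r+1$ steps. -}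

module Defs where

open import Data.Nat using (ℕ; zero; suc; _+_; _≤_)
open import Data.List using (List; []; _∷_; length)
open import Data.List.Relation.Unary.All using (All)
open import Data.Product using (_×_; _,_; proj₁; proj₂; Σ)
open import Data.Sum using (_⊎_)
open import Data.Unit using (⊤)
open import Relation.Binary.PropositionalEquality using (_≡_)

data Letter : Set where
  Lu Lm R : Letter

ProperlyMarked : List Letter → Set
ProperlyMarked []             = ⊤
ProperlyMarked (Lu ∷ w)       = ProperlyMarked w
ProperlyMarked (R ∷ w)        = ProperlyMarked w
ProperlyMarked (Lm ∷ [])      = ⊤
ProperlyMarked (Lm ∷ y ∷ w)   = (y ≡ Lu ⊎ y ≡ Lm) × ProperlyMarked (y ∷ w)

#marked : List Letter → ℕ
#marked []       = 0
#marked (Lm ∷ w) = suc (#marked w)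
#marked (Lu ∷ w) = #marked w
#marked (R ∷ w)  = #marked w

#unmarked : List Letter → ℕ
#unmarked []       = 0
#unmarked (Lu ∷ w) = suc (#unmarked w)
#unmarked (Lm ∷ w) = #unmarked w
#unmarked (R ∷ w)  = #unmarked w

PMWords : ℕ → ℕ → ℕ → Set
PMWords len k r =
  Σ (List Letter) λ w →
    ProperlyMarked w × length w ≡ len × #marked w ≡ k × #unmarked w ≡ r

Step : Set
Step = ℕ × ℕ

ValidStep : Step → Set
ValidStep s = 1 ≤ proj₁ s

sumX : List Step → ℕ
sumX []       = 0
sumX (s ∷ ss) = proj₁ s + sumX ss

sumY : List Step → ℕ
sumY []       = 0
sumY (s ∷ ss) = proj₂ s + sumY ss

-- Set (2): Kimberling paths (given by their list of steps, starting at
-- (0,0)) ending at (x , y) with r internal vertices, i.e. r+1 steps.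
KimberlingPaths : ℕ → ℕ → ℕ → Set
KimberlingPaths x y r =
  Σ (List Step) λ ss →
    All ValidStep ss × length ss ≡ suc r × sumX ss ≡ x × sumY ss ≡ y

-- Both sets split as a product of two families each counted by a binomial
-- coefficient. A properly-marked word is determined by the two binary words
-- obtained by erasing its marked letters and by erasing its R's: the first
-- has r letters L^u and n-k-r-1 letters R, the second r letters L^u and k
-- letters L^m, and conversely any such pair is merged back in exactly one
-- properly-marked way (each run of L^m must end right before an L^u or at the
-- end of the word). A Kimberling path with r+1 steps ending at (n-k, k) is
-- the pair of its horizontal and vertical displacements: a weak composition
-- of n-k-r-1 (the widths minus one) and one of k, both into r+1 parts. Binary
-- words and weak compositions are counted by Pascal's rule.
module Submission where

open import Defs
open import Algebra.Properties.CommutativeSemigroup using (x∙yz≈y∙xz)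
open import Data.Bool using (Bool; true; false)
open import Data.Empty using (⊥-elim)
open import Data.Fin using (Fin)
open import Data.Fin.Properties using (1↔⊤; +↔⊎; *↔×)
open import Data.List using (List; []; _∷_; length; map; replicate; zipWith; head)
open import Data.List.Properties using (length-map; length-replicate)
open import Data.List.Relation.Unary.All as All using (All; []; _∷_)
open import Data.Maybe using (just)
open import Data.Nat using (ℕ; zero; suc; pred; _+_; _*_; _∸_; _≤_; s≤s; z≤n)
open import Data.Nat.Combinatorics using (_C_; nCn≡1; nCk+nC[k+1]≡[n+1]C[k+1])
open import Data.Nat.ListAction using (sum)
open import Data.Nat.Properties
  using (≡-irrelevant; ≤-irrelevant; suc-injective; +-suc; +-assoc; +-identityʳ;
         +-cancelˡ-≡; m+n∸m≡n; m≤n⇒∃[o]m+o≡n; +-commutativeSemigroup)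
open import Data.Product using (Σ; _×_; _,_; proj₁; proj₂)
open import Data.Product.Function.NonDependent.Propositional using (_×-↔_)
open import Data.Sum using (_⊎_; inj₁; inj₂)
open import Data.Sum.Function.Propositional using (_⊎-↔_)
open import Data.Unit using (⊤; tt)
open import Function using (_∘_)
open import Function.Bundles using (_↔_; mk↔ₛ′)
open import Function.Properties.Inverse using (↔-refl; ↔-sym; ↔-trans)
open import Relation.Binary.PropositionalEquality
  using (_≡_; _≢_; refl; sym; trans; cong; cong₂)
open import Relation.Nullary.Irrelevant using (Irrelevant)

Σ-≡-proj₁ : {A : Set} {P : A → Set} → (∀ {a} → Irrelevant (P a)) →
            {x y : Σ A P} → proj₁ x ≡ proj₁ y → x ≡ y
Σ-≡-proj₁ irr {a , p} {.a , q} refl = cong (a ,_) (irr p q)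

×-irrelevant : {A B : Set} → Irrelevant A → Irrelevant B → Irrelevant (A × B)
×-irrelevant irrA irrB (a , b) (a′ , b′) = cong₂ _,_ (irrA a a′) (irrB b b′)

≡×≡-irrelevant : {a b c d : ℕ} → Irrelevant (a ≡ b × c ≡ d)
≡×≡-irrelevant = ×-irrelevant ≡-irrelevant ≡-irrelevant

contractible↔⊤ : {A : Set} (c : A) → (∀ x → c ≡ x) → A ↔ ⊤
contractible↔⊤ c unique = mk↔ₛ′ (λ _ → tt) (λ _ → c) (λ { tt → refl }) unique

Fin-cong : {m n : ℕ} → m ≡ n → Fin m ↔ Fin n
Fin-cong refl = ↔-refl

pascal-count : (T : ℕ → ℕ → Set) →
  (∀ b → T 0 b ↔ ⊤) →
  (∀ a → T (suc a) 0 ↔ ⊤) →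
  (∀ a b → T (suc a) (suc b) ↔ (T a (suc b) ⊎ T (suc a) b)) →
  ∀ a b → T a b ↔ Fin ((a + b) C a)
pascal-count T left-edge right-edge split = count
  where
  count : ∀ a b → T a b ↔ Fin ((a + b) C a)
  count zero b = ↔-trans (left-edge b) (↔-sym 1↔⊤)
  count (suc a) zero =
    ↔-trans (right-edge a) (↔-trans (↔-sym 1↔⊤) (Fin-cong (sym diagonal)))
    where
    diagonal : (suc a + 0) C suc a ≡ 1
    diagonal = trans (cong (_C suc a) (+-identityʳ (suc a))) (nCn≡1 (suc a))
  count (suc a) (suc b) =
    ↔-trans (split a b)
      (↔-trans (count a (suc b) ⊎-↔ count (suc a) b)
        (↔-trans (↔-sym +↔⊎) (Fin-cong pascal)))
    where
    pascal : (a + suc b) C a + (suc a + b) C suc a ≡ (suc a + suc b) C suc a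
    pascal = trans (cong (λ m → (a + suc b) C a + m C suc a) (sym (+-suc a b)))
                   (nCk+nC[k+1]≡[n+1]C[k+1] (a + suc b) a)

-- Binary words

#true : List Bool → ℕ
#true []          = 0
#true (true ∷ u)  = suc (#true u)
#true (false ∷ u) = #true u

#false : List Bool → ℕ
#false []          = 0
#false (true ∷ u)  = #false u
#false (false ∷ u) = suc (#false u)

BinaryWords : ℕ → ℕ → Set
BinaryWords a b = Σ (List Bool) λ u → #true u ≡ a × #false u ≡ b

#true≡0⇒replicate-false : ∀ u → #true u ≡ 0 → u ≡ replicate (#false u) false
#true≡0⇒replicate-false []          _  = refl
#true≡0⇒replicate-false (false ∷ u) eq = cong (false ∷_) (#true≡0⇒replicate-false u eq)

#false≡0⇒replicate-true : ∀ u → #false u ≡ 0 → u ≡ replicate (#true u) true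
#false≡0⇒replicate-true []         _  = refl
#false≡0⇒replicate-true (true ∷ u) eq = cong (true ∷_) (#false≡0⇒replicate-true u eq)

#true-replicate-false : ∀ n → #true (replicate n false) ≡ 0
#true-replicate-false zero    = refl
#true-replicate-false (suc n) = #true-replicate-false n

#false-replicate-false : ∀ n → #false (replicate n false) ≡ n
#false-replicate-false zero    = refl
#false-replicate-false (suc n) = cong suc (#false-replicate-false n)

#true-replicate-true : ∀ n → #true (replicate n true) ≡ n
#true-replicate-true zero    = refl
#true-replicate-true (suc n) = cong suc (#true-replicate-true n)

#false-replicate-true : ∀ n → #false (replicate n true) ≡ 0
#false-replicate-true zero    = refl
#false-replicate-true (suc n) = #false-replicate-true n

BinaryWords-no-true : ∀ b → BinaryWords 0 b ↔ ⊤
BinaryWords-no-true b =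
  contractible↔⊤ (replicate b false , #true-replicate-false b , #false-replicate-false b)
    λ (u , t , f) → Σ-≡-proj₁ ≡×≡-irrelevant
      (trans (cong (λ m → replicate m false) (sym f)) (sym (#true≡0⇒replicate-false u t)))

BinaryWords-no-false : ∀ a → BinaryWords a 0 ↔ ⊤
BinaryWords-no-false a =
  contractible↔⊤ (replicate a true , #true-replicate-true a , #false-replicate-true a)
    λ (u , t , f) → Σ-≡-proj₁ ≡×≡-irrelevant
      (trans (cong (λ m → replicate m true) (sym t)) (sym (#false≡0⇒replicate-true u f)))

BinaryWords-split : ∀ a b →
  BinaryWords (suc a) (suc b) ↔ (BinaryWords a (suc b) ⊎ BinaryWords (suc a) b)
BinaryWords-split a b = mk↔ₛ′ to from to∘from from∘to
  where
  to : BinaryWords (suc a) (suc b) → BinaryWords a (suc b) ⊎ BinaryWords (suc a) b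
  to (true ∷ u  , t , f) = inj₁ (u , suc-injective t , f)
  to (false ∷ u , t , f) = inj₂ (u , t , suc-injective f)
  from : BinaryWords a (suc b) ⊎ BinaryWords (suc a) b → BinaryWords (suc a) (suc b)
  from (inj₁ (u , t , f)) = true ∷ u , cong suc t , f
  from (inj₂ (u , t , f)) = false ∷ u , t , cong suc f
  to∘from : ∀ x → to (from x) ≡ x
  to∘from (inj₁ (u , t , f)) = cong inj₁ (Σ-≡-proj₁ ≡×≡-irrelevant refl)
  to∘from (inj₂ (u , t , f)) = cong inj₂ (Σ-≡-proj₁ ≡×≡-irrelevant refl)
  from∘to : ∀ x → from (to x) ≡ x
  from∘to (true ∷ u  , t , f) = Σ-≡-proj₁ ≡×≡-irrelevant refl
  from∘to (false ∷ u , t , f) = Σ-≡-proj₁ ≡×≡-irrelevant refl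

BinaryWords↔ : ∀ a b → BinaryWords a b ↔ Fin ((a + b) C a)
BinaryWords↔ = pascal-count BinaryWords BinaryWords-no-true
  (BinaryWords-no-false ∘ suc) BinaryWords-split

-- Weak compositions

WeakCompositions : ℕ → ℕ → Set
WeakCompositions y m = Σ (List ℕ) λ cs → length cs ≡ m × sum cs ≡ y

sum≡0⇒replicate-0 : ∀ cs → sum cs ≡ 0 → cs ≡ replicate (length cs) 0
sum≡0⇒replicate-0 []           _  = refl
sum≡0⇒replicate-0 (zero ∷ cs) eq = cong (0 ∷_) (sum≡0⇒replicate-0 cs eq)

sum-replicate-0 : ∀ m → sum (replicate m 0) ≡ 0
sum-replicate-0 zero    = refl
sum-replicate-0 (suc m) = sum-replicate-0 m

WeakCompositions-one-part : ∀ y → WeakCompositions y 1 ↔ ⊤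
WeakCompositions-one-part y = contractible↔⊤ (y ∷ [] , refl , +-identityʳ y) unique
  where
  unique : ∀ x → (y ∷ [] , refl , +-identityʳ y) ≡ x
  unique (c ∷ [] , refl , s) =
    Σ-≡-proj₁ ≡×≡-irrelevant (cong (_∷ []) (trans (sym s) (+-identityʳ c)))

WeakCompositions-of-0 : ∀ m → WeakCompositions 0 m ↔ ⊤
WeakCompositions-of-0 m =
  contractible↔⊤ (replicate m 0 , length-replicate m , sum-replicate-0 m)
    λ (cs , l , s) → Σ-≡-proj₁ ≡×≡-irrelevant
      (trans (cong (λ n → replicate n 0) (sym l)) (sym (sum≡0⇒replicate-0 cs s)))

WeakCompositions-split : ∀ r y →
  WeakCompositions (suc y) (suc (suc r)) ↔
  (WeakCompositions (suc y) (suc r) ⊎ WeakCompositions y (suc (suc r)))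
WeakCompositions-split r y = mk↔ₛ′ to from to∘from from∘to
  where
  to : WeakCompositions (suc y) (suc (suc r)) →
       WeakCompositions (suc y) (suc r) ⊎ WeakCompositions y (suc (suc r))
  to (zero ∷ cs  , l , s) = inj₁ (cs , suc-injective l , s)
  to (suc c ∷ cs , l , s) = inj₂ (c ∷ cs , l , suc-injective s)
  from : WeakCompositions (suc y) (suc r) ⊎ WeakCompositions y (suc (suc r)) →
         WeakCompositions (suc y) (suc (suc r))
  from (inj₁ (cs , l , s))     = 0 ∷ cs , cong suc l , s
  from (inj₂ (c ∷ cs , l , s)) = suc c ∷ cs , l , cong suc s
  to∘from : ∀ x → to (from x) ≡ x
  to∘from (inj₁ (cs , l , s))     = cong inj₁ (Σ-≡-proj₁ ≡×≡-irrelevant refl)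
  to∘from (inj₂ (c ∷ cs , l , s)) = cong inj₂ (Σ-≡-proj₁ ≡×≡-irrelevant refl)
  from∘to : ∀ x → from (to x) ≡ x
  from∘to (zero ∷ cs  , l , s) = Σ-≡-proj₁ ≡×≡-irrelevant refl
  from∘to (suc c ∷ cs , l , s) = Σ-≡-proj₁ ≡×≡-irrelevant refl

WeakCompositions↔ : ∀ r y → WeakCompositions y (suc r) ↔ Fin ((r + y) C r)
WeakCompositions↔ = pascal-count (λ r y → WeakCompositions y (suc r))
  WeakCompositions-one-part (WeakCompositions-of-0 ∘ suc ∘ suc) WeakCompositions-split

-- Properly-marked words

eraseMarked : List Letter → List Bool
eraseMarked []       = []
eraseMarked (Lu ∷ w) = true ∷ eraseMarked w
eraseMarked (Lm ∷ w) = eraseMarked w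
eraseMarked (R ∷ w)  = false ∷ eraseMarked w

eraseR : List Letter → List Bool
eraseR []       = []
eraseR (Lu ∷ w) = true ∷ eraseR w
eraseR (Lm ∷ w) = false ∷ eraseR w
eraseR (R ∷ w)  = eraseR w

-- Inverse of w ↦ (eraseMarked w , eraseR w): the letters true of both words
-- are the common L^u's, R's are emitted as early and L^m's as late as
-- possible. The last two clauses only occur for unequal numbers of true.
merge : List Bool → List Bool → List Letter
merge (false ∷ u) v           = R ∷ merge u v
merge u           (false ∷ v) = Lm ∷ merge u v
merge (true ∷ u)  (true ∷ v)  = Lu ∷ merge u v
merge []          []          = []
merge (true ∷ u)  []          = Lu ∷ merge u []
merge []          (true ∷ v)  = Lu ∷ merge [] v

ProperlyMarked-Lm∷ : ∀ w → ProperlyMarked w → head w ≢ just R → ProperlyMarked (Lm ∷ w)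
ProperlyMarked-Lm∷ []       _  _   = tt
ProperlyMarked-Lm∷ (Lu ∷ w) pm _   = inj₁ refl , pm
ProperlyMarked-Lm∷ (Lm ∷ w) pm _   = inj₂ refl , pm
ProperlyMarked-Lm∷ (R ∷ w)  _  ¬R  = ⊥-elim (¬R refl)

ProperlyMarked-Lm∷⁻¹ : ∀ w → ProperlyMarked (Lm ∷ w) → ProperlyMarked w
ProperlyMarked-Lm∷⁻¹ []      _         = tt
ProperlyMarked-Lm∷⁻¹ (_ ∷ _) (_ , pm) = pm

head-merge : ∀ u v → head u ≢ just false → head (merge u v) ≢ just R
head-merge (false ∷ u) v           ¬false = ⊥-elim (¬false refl)
head-merge []          (false ∷ v) _      = λ ()
head-merge []          (true ∷ v)  _      = λ ()
head-merge []          []          _      = λ ()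
head-merge (true ∷ u)  (false ∷ v) _      = λ ()
head-merge (true ∷ u)  (true ∷ v)  _      = λ ()
head-merge (true ∷ u)  []          _      = λ ()

merge-properlyMarked : ∀ u v → ProperlyMarked (merge u v)
merge-properlyMarked (false ∷ u) v           = merge-properlyMarked u v
merge-properlyMarked []          (false ∷ v) =
  ProperlyMarked-Lm∷ (merge [] v) (merge-properlyMarked [] v) (head-merge [] v λ ())
merge-properlyMarked (true ∷ u)  (false ∷ v) =
  ProperlyMarked-Lm∷ (merge (true ∷ u) v) (merge-properlyMarked (true ∷ u) v)
    (head-merge (true ∷ u) v λ ())
merge-properlyMarked (true ∷ u)  (true ∷ v)  = merge-properlyMarked u v
merge-properlyMarked []          []          = tt
merge-properlyMarked (true ∷ u)  []          = merge-properlyMarked u []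
merge-properlyMarked []          (true ∷ v)  = merge-properlyMarked [] v

merge-Lm : ∀ u v → head u ≢ just false → merge u (false ∷ v) ≡ Lm ∷ merge u v
merge-Lm []          v _      = refl
merge-Lm (true ∷ u)  v _      = refl
merge-Lm (false ∷ u) v ¬false = ⊥-elim (¬false refl)

head-eraseMarked : ∀ w → ProperlyMarked (Lm ∷ w) → head (eraseMarked w) ≢ just false
head-eraseMarked []       _             = λ ()
head-eraseMarked (Lu ∷ w) _             = λ ()
head-eraseMarked (Lm ∷ w) (_ , pm)      = head-eraseMarked w pm
head-eraseMarked (R ∷ w)  (inj₁ () , _)
head-eraseMarked (R ∷ w)  (inj₂ () , _)

merge-erase : ∀ w → ProperlyMarked w → merge (eraseMarked w) (eraseR w) ≡ w
merge-erase []       _  = refl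
merge-erase (Lu ∷ w) pm = cong (Lu ∷_) (merge-erase w pm)
merge-erase (R ∷ w)  pm = cong (R ∷_) (merge-erase w pm)
merge-erase (Lm ∷ w) pm = trans
  (merge-Lm (eraseMarked w) (eraseR w) (head-eraseMarked w pm))
  (cong (Lm ∷_) (merge-erase w (ProperlyMarked-Lm∷⁻¹ w pm)))

eraseMarked-merge : ∀ u v → #true u ≡ #true v → eraseMarked (merge u v) ≡ u
eraseMarked-merge (false ∷ u) v           eq = cong (false ∷_) (eraseMarked-merge u v eq)
eraseMarked-merge []          (false ∷ v) eq = eraseMarked-merge [] v eq
eraseMarked-merge (true ∷ u)  (false ∷ v) eq = eraseMarked-merge (true ∷ u) v eq
eraseMarked-merge (true ∷ u)  (true ∷ v)  eq =
  cong (true ∷_) (eraseMarked-merge u v (suc-injective eq))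
eraseMarked-merge []          []          _  = refl
eraseMarked-merge (true ∷ u)  []          ()
eraseMarked-merge []          (true ∷ v)  ()

eraseR-merge : ∀ u v → #true u ≡ #true v → eraseR (merge u v) ≡ v
eraseR-merge (false ∷ u) v           eq = eraseR-merge u v eq
eraseR-merge []          (false ∷ v) eq = cong (false ∷_) (eraseR-merge [] v eq)
eraseR-merge (true ∷ u)  (false ∷ v) eq = cong (false ∷_) (eraseR-merge (true ∷ u) v eq)
eraseR-merge (true ∷ u)  (true ∷ v)  eq =
  cong (true ∷_) (eraseR-merge u v (suc-injective eq))
eraseR-merge []          []          _  = refl
eraseR-merge (true ∷ u)  []          ()
eraseR-merge []          (true ∷ v)  ()

ProperlyMarked-irrelevant : ∀ w → Irrelevant (ProperlyMarked w)
ProperlyMarked-irrelevant []           tt tt = refl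
ProperlyMarked-irrelevant (Lu ∷ w)     p  q  = ProperlyMarked-irrelevant w p q
ProperlyMarked-irrelevant (R ∷ w)      p  q  = ProperlyMarked-irrelevant w p q
ProperlyMarked-irrelevant (Lm ∷ [])    tt tt = refl
ProperlyMarked-irrelevant (Lm ∷ y ∷ w) (e , p) (f , q) =
  cong₂ _,_ (next-irrelevant e f) (ProperlyMarked-irrelevant (y ∷ w) p q)
  where
  next-irrelevant : Irrelevant (y ≡ Lu ⊎ y ≡ Lm)
  next-irrelevant (inj₁ refl) (inj₁ refl) = refl
  next-irrelevant (inj₂ refl) (inj₂ refl) = refl
  next-irrelevant (inj₁ refl) (inj₂ ())
  next-irrelevant (inj₂ refl) (inj₁ ())

#true-eraseMarked : ∀ w → #true (eraseMarked w) ≡ #unmarked w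
#true-eraseMarked []       = refl
#true-eraseMarked (Lu ∷ w) = cong suc (#true-eraseMarked w)
#true-eraseMarked (Lm ∷ w) = #true-eraseMarked w
#true-eraseMarked (R ∷ w)  = #true-eraseMarked w

#true-eraseR : ∀ w → #true (eraseR w) ≡ #unmarked w
#true-eraseR []       = refl
#true-eraseR (Lu ∷ w) = cong suc (#true-eraseR w)
#true-eraseR (Lm ∷ w) = #true-eraseR w
#true-eraseR (R ∷ w)  = #true-eraseR w

#false-eraseR : ∀ w → #false (eraseR w) ≡ #marked w
#false-eraseR []       = refl
#false-eraseR (Lu ∷ w) = #false-eraseR w
#false-eraseR (Lm ∷ w) = cong suc (#false-eraseR w)
#false-eraseR (R ∷ w)  = #false-eraseR w

-- #false (eraseMarked w) is the number of letters R of w.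
length-by-letter : ∀ w → length w ≡ #marked w + (#unmarked w + #false (eraseMarked w))
length-by-letter []       = refl
length-by-letter (Lm ∷ w) = cong suc (length-by-letter w)
length-by-letter (Lu ∷ w) =
  trans (cong suc (length-by-letter w)) (sym (+-suc (#marked w) _))
length-by-letter (R ∷ w)  = trans (cong suc (length-by-letter w))
  (sym (trans (cong (#marked w +_) (+-suc (#unmarked w) _)) (+-suc (#marked w) _)))

PMWords↔BinaryWords² : ∀ k r z →
  PMWords (k + (r + z)) k r ↔ (BinaryWords r z × BinaryWords r k)
PMWords↔BinaryWords² k r z = mk↔ₛ′ to from to∘from from∘to
  where
  irrelevant : ∀ w → Irrelevant
    (ProperlyMarked w × length w ≡ k + (r + z) × #marked w ≡ k × #unmarked w ≡ r)
  irrelevant w = ×-irrelevant (ProperlyMarked-irrelevant w)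
    (×-irrelevant ≡-irrelevant ≡×≡-irrelevant)

  to : PMWords (k + (r + z)) k r → BinaryWords r z × BinaryWords r k
  to (w , _ , len , mk , um) =
    (eraseMarked w , trans (#true-eraseMarked w) um , #R≡z) ,
    (eraseR w , trans (#true-eraseR w) um , trans (#false-eraseR w) mk)
    where
    #R≡z : #false (eraseMarked w) ≡ z
    #R≡z = +-cancelˡ-≡ (#unmarked w) _ _ (+-cancelˡ-≡ (#marked w) _ _
      (trans (sym (length-by-letter w))
        (trans len (cong₂ (λ a b → a + (b + z)) (sym mk) (sym um)))))

  from : BinaryWords r z × BinaryWords r k → PMWords (k + (r + z)) k r
  from ((u , tu , fu) , (v , tv , fv)) =
    w , merge-properlyMarked u v ,
    trans (length-by-letter w) (cong₂ _+_ mk (cong₂ _+_ um #R≡z)) , mk , um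
    where
    w : List Letter
    w = merge u v
    balanced : #true u ≡ #true v
    balanced = trans tu (sym tv)
    um : #unmarked w ≡ r
    um = trans (sym (#true-eraseMarked w))
               (trans (cong #true (eraseMarked-merge u v balanced)) tu)
    mk : #marked w ≡ k
    mk = trans (sym (#false-eraseR w)) (trans (cong #false (eraseR-merge u v balanced)) fv)
    #R≡z : #false (eraseMarked w) ≡ z
    #R≡z = trans (cong #false (eraseMarked-merge u v balanced)) fu

  to∘from : ∀ x → to (from x) ≡ x
  to∘from ((u , tu , _) , (v , tv , _)) = cong₂ _,_
    (Σ-≡-proj₁ ≡×≡-irrelevant (eraseMarked-merge u v (trans tu (sym tv))))
    (Σ-≡-proj₁ ≡×≡-irrelevant (eraseR-merge u v (trans tu (sym tv))))

  from∘to : ∀ x → from (to x) ≡ x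
  from∘to (w , pm , _) = Σ-≡-proj₁ (λ {w} → irrelevant w) (merge-erase w pm)

-- Kimberling paths

widths : List Step → List ℕ
widths = map (pred ∘ proj₁)

heights : List Step → List ℕ
heights = map proj₂

steps : List ℕ → List ℕ → List Step
steps = zipWith (λ a b → suc a , b)

steps-valid : ∀ as bs → All ValidStep (steps as bs)
steps-valid []       _        = []
steps-valid (_ ∷ _)  []       = []
steps-valid (_ ∷ as) (_ ∷ bs) = s≤s z≤n ∷ steps-valid as bs

widths-steps : ∀ as bs → length as ≡ length bs → widths (steps as bs) ≡ as
widths-steps []       []       _  = refl
widths-steps (a ∷ as) (_ ∷ bs) eq = cong (a ∷_) (widths-steps as bs (suc-injective eq))

heights-steps : ∀ as bs → length as ≡ length bs → heights (steps as bs) ≡ bs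
heights-steps []       []       _  = refl
heights-steps (_ ∷ as) (b ∷ bs) eq = cong (b ∷_) (heights-steps as bs (suc-injective eq))

steps-widths-heights : ∀ {ss} → All ValidStep ss → steps (widths ss) (heights ss) ≡ ss
steps-widths-heights []                                  = refl
steps-widths-heights {(suc a , b) ∷ _} (s≤s z≤n ∷ valid) =
  cong ((suc a , b) ∷_) (steps-widths-heights valid)

sumX≡length+sum-widths : ∀ {ss} → All ValidStep ss → sumX ss ≡ length ss + sum (widths ss)
sumX≡length+sum-widths []                                  = refl
sumX≡length+sum-widths {(suc a , _) ∷ ss} (s≤s z≤n ∷ valid) = cong suc (trans
  (cong (a +_) (sumX≡length+sum-widths valid))
  (x∙yz≈y∙xz +-commutativeSemigroup a (length ss) (sum (widths ss))))

sumY≡sum-heights : ∀ ss → sumY ss ≡ sum (heights ss)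
sumY≡sum-heights []       = refl
sumY≡sum-heights (s ∷ ss) = cong (proj₂ s +_) (sumY≡sum-heights ss)

KimberlingPaths↔WeakCompositions² : ∀ k r z →
  KimberlingPaths (suc (r + z)) k r ↔ (WeakCompositions z (suc r) × WeakCompositions k (suc r))
KimberlingPaths↔WeakCompositions² k r z = mk↔ₛ′ to from to∘from from∘to
  where
  irrelevant : ∀ ss → Irrelevant
    (All ValidStep ss × length ss ≡ suc r × sumX ss ≡ suc (r + z) × sumY ss ≡ k)
  irrelevant ss = ×-irrelevant (All.irrelevant ≤-irrelevant)
    (×-irrelevant ≡-irrelevant ≡×≡-irrelevant)

  to : KimberlingPaths (suc (r + z)) k r →
       WeakCompositions z (suc r) × WeakCompositions k (suc r)
  to (ss , valid , len , x , y) =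
    (widths ss , trans (length-map _ ss) len , sum-widths≡z) ,
    (heights ss , trans (length-map _ ss) len , trans (sym (sumY≡sum-heights ss)) y)
    where
    sum-widths≡z : sum (widths ss) ≡ z
    sum-widths≡z = +-cancelˡ-≡ (length ss) _ _
      (trans (sym (sumX≡length+sum-widths valid)) (trans x (cong (_+ z) (sym len))))

  from : WeakCompositions z (suc r) × WeakCompositions k (suc r) →
         KimberlingPaths (suc (r + z)) k r
  from ((as , la , sa) , (bs , lb , sb)) =
    ss , valid , len ,
    trans (sumX≡length+sum-widths valid) (cong₂ _+_ len (trans (cong sum ws) sa)) ,
    trans (sumY≡sum-heights ss) (trans (cong sum (heights-steps as bs same)) sb)
    where
    ss : List Step
    ss = steps as bs
    valid : All ValidStep ss
    valid = steps-valid as bs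
    same : length as ≡ length bs
    same = trans la (sym lb)
    ws : widths ss ≡ as
    ws = widths-steps as bs same
    len : length ss ≡ suc r
    len = trans (sym (length-map _ ss)) (trans (cong length ws) la)

  to∘from : ∀ x → to (from x) ≡ x
  to∘from ((as , la , _) , (bs , lb , _)) = cong₂ _,_
    (Σ-≡-proj₁ ≡×≡-irrelevant (widths-steps as bs (trans la (sym lb))))
    (Σ-≡-proj₁ ≡×≡-irrelevant (heights-steps as bs (trans la (sym lb))))

  from∘to : ∀ x → from (to x) ≡ x
  from∘to (ss , valid , _) = Σ-≡-proj₁ (λ {ss} → irrelevant ss) (steps-widths-heights valid)

PMWords-count : ∀ k r z →
  PMWords (k + (r + z)) k r ↔ Fin (((r + z) C r) * ((r + k) C r))
PMWords-count k r z = ↔-trans (PMWords↔BinaryWords² k r z)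
  (↔-trans (BinaryWords↔ r z ×-↔ BinaryWords↔ r k) (↔-sym *↔×))

KimberlingPaths-count : ∀ k r z →
  KimberlingPaths (suc (r + z)) k r ↔ Fin (((r + z) C r) * ((r + k) C r))
KimberlingPaths-count k r z = ↔-trans (KimberlingPaths↔WeakCompositions² k r z)
  (↔-trans (WeakCompositions↔ r z ×-↔ WeakCompositions↔ r k) (↔-sym *↔×))

corollary5p11 : (n k r : ℕ) → 1 ≤ n → k + r ≤ n ∸ 1 →
    (PMWords (n ∸ 1) k r ↔ Fin (((n ∸ k ∸ 1) C r) * ((r + k) C r)))
    × (KimberlingPaths (n ∸ k) k r ↔ Fin (((n ∸ k ∸ 1) C r) * ((r + k) C r)))
corollary5p11 zero    k r () _
corollary5p11 (suc n) k r _ k+r≤n with m≤n⇒∃[o]m+o≡n k+r≤n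
... | z , refl
  rewrite +-assoc k r z | sym (+-suc k (r + z)) | m+n∸m≡n k (suc (r + z))
  = PMWords-count k r z , KimberlingPaths-count k r z
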